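{- Let $p$ and $p'$ be programs of the split fireball calculus and let $\pi\triangleright\Gamma\vdash p:M$ be a type derivation. If $p\to_{\beta_f} p'$ then $|\pi|>0$ and there exists a type derivation $\pi'\triangleright\Gamma\vdash p':M$ such that $|\pi'|=|\pi|-1$.
   Context: Terms: $t,u ::= x \mid \lambda x.t \mid tu$, up to $\alpha$-equivalence; $t\{x\leftarrow u\}$ is capture-avoiding substitution. Values: $v ::= x \mid \lambda x.t$. Fireballs $f$ and inert terms $i$ are defined by mutual induction: $f ::= v \mid i$ and $i ::= x f_1 \dots f_n$ with $n>0$. Right evaluation contexts: $C ::= \langle\cdot\rangle \mid t\,C \mid C\,f$. Split fireball calculus: environments $E ::= \epsilon \mid [x\leftarrow i]:E$; programs $p=(t,E)$. Reduction: $(C\langle(\lambda x.t)v\rangle,E)\to_{\beta_v}(C\langle t\{x\leftarrow v\}\rangle,E)$ and $(C\langle(\lambda x.t)i\rangle,E)\to_{\beta_i}(C\langle t\rangle,[x\leftarrow i]:E)$; $\to_{\beta_f}=\to_{\beta_v}\cup\to_{\beta_i}$. Append: $\epsilon@[x\leftarrow i]=[x\leftarrow i]$, $([y\leftarrow i']:E)@[x\leftarrow i]=[y\leftarrow i']:(E@[x\leftarrow i])$. Multi types: linear types $L ::= M\multimap N$; multi types $M,N ::= [L_1,\dots,L_n]$ (finite multisets, $n\ge 0$); $\mathbf 0$ empty multiset, $\uplus$ multiset sum. Type context $\Gamma$: total map from variables to multi types with finite $\mathrm{dom}(\Gamma)=\{x\mid \Gamma(x)\ne\mathbf 0\}$;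 $(\Gamma\uplus\Delta)(x)=\Gamma(x)\uplus\Delta(x)$; $x:M$ maps $x$ to $M$ and all else to $\mathbf 0$; $\Gamma,x:M$ extends $\Gamma$ ($x\notin\mathrm{dom}(\Gamma)$) by $x\mapsto M$. Typing rules: (ax) $x:M\vdash x:M$; (@) from $\Gamma\vdash t:[M\multimap N]$ and $\Delta\vdash u:M$ infer $\Gamma\uplus\Delta\vdash tu:N$; ($\lambda$) from $\Gamma_k,x:M_k\vdash t:N_k$ for $k=1,\dots,n$ ($n\ge0$) infer $\Gamma_1\uplus\dots\uplus\Gamma_n\vdash\lambda x.t:[M_1\multimap N_1,\dots,M_n\multimap N_n]$; (es$_\epsilon$) from $\Gamma\vdash t:M$ infer $\Gamma\vdash (t,\epsilon):M$; (es$_@$) from $\Gamma,x:M\vdash(t,E):N$ and $\Delta\vdash i:M$ infer $\Gamma\uplus\Delta\vdash(t,E@[x\leftarrow i]):N$. $|\pi|$ is the number of (@) rules in $\pi$. -}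

module Defs where

open import Data.Nat using (ℕ; zero; suc; _+_; _≟_)
open import Data.Fin using (Fin; zero; suc)
open import Data.List using (List; []; _∷_; _++_; [_]; concatMap)
open import Data.List.Membership.Propositional using (_∉_)
open import Data.Product using (Σ; _×_; _,_; proj₁)
open import Data.Bool using (if_then_else_)
open import Relation.Nullary using (does)
open import Relation.Binary.PropositionalEquality using (_≡_)

-- Terms up to α-equivalence: locally nameless, well-scoped de Bruijn
-- indices for bound variables, names (ℕ) for free variables.

Var : Set
Var = ℕ

data Tm (n : ℕ) : Set where
  bv  : Fin n → Tm n
  fv  : Var → Tm n
  lam : Tm (suc n) → Tm n
  app : Tm n → Tm n → Tm n

ext : ∀ {m n} → (Fin m → Fin n) → Fin (suc m) → Fin (suc n)
ext ρ zero    = zero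
ext ρ (suc i) = suc (ρ i)

ren : ∀ {m n} → (Fin m → Fin n) → Tm m → Tm n
ren ρ (bv i)    = bv (ρ i)
ren ρ (fv x)    = fv x
ren ρ (lam t)   = lam (ren (ext ρ) t)
ren ρ (app t u) = app (ren ρ t) (ren ρ u)

exts : ∀ {m n} → (Fin m → Tm n) → Fin (suc m) → Tm (suc n)
exts σ zero    = bv zero
exts σ (suc i) = ren suc (σ i)

sub : ∀ {m n} → (Fin m → Tm n) → Tm m → Tm n
sub σ (bv i)    = σ i
sub σ (fv x)    = fv x
sub σ (lam t)   = lam (sub (exts σ) t)
sub σ (app t u) = app (sub σ t) (sub σ u)

σ₀ : Tm 0 → Fin 1 → Tm 0
σ₀ u zero = u

_⟦_⟧ : Tm 1 → Tm 0 → Tm 0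
t ⟦ u ⟧ = sub (σ₀ u) t

_^_ : Tm 1 → Var → Tm 0
t ^ x = t ⟦ fv x ⟧

fvs : ∀ {n} → Tm n → List Var
fvs (bv i)    = []
fvs (fv x)    = x ∷ []
fvs (lam t)   = fvs t
fvs (app t u) = fvs t ++ fvs u

data IsValue : Tm 0 → Set where
  var : ∀ x → IsValue (fv x)
  abs : ∀ t → IsValue (lam t)

data IsFireball : Tm 0 → Set
data IsInert : Tm 0 → Set

data IsFireball where
  val : ∀ {v} → IsValue v → IsFireball v
  ine : ∀ {i} → IsInert i → IsFireball i

data IsInert where
  head : ∀ x {f} → IsFireball f → IsInert (app (fv x) f)
  more : ∀ {i f} → IsInert i → IsFireball f → IsInert (app i f)

Inert : Set
Inert = Σ (Tm 0) IsInert

data ECtx : Set where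
  hole : ECtx
  _·C_ : Tm 0 → ECtx → ECtx
  _C·_ : ∀ {f} → ECtx → IsFireball f → ECtx

plug : ECtx → Tm 0 → Tm 0
plug hole      s = s
plug (t ·C C)  s = app t (plug C s)
plug (_C·_ {f} C _) s = app (plug C s) f

Entry : Set
Entry = Var × Inert

-- E ::= ε | [x←i] : E   (ε = [], [x←i]:E = (x , i) ∷ E, E @ [x←i] = E ++ [ (x , i) ])
Env : Set
Env = List Entry

record Program : Set where
  constructor ⟨_,_⟩
  field
    term : Tm 0
    env  : Env

names : Program → List Var
names ⟨ t , E ⟩ = fvs t ++ concatMap (λ { (x , i) → x ∷ fvs (proj₁ i) }) E

infix 4 _→βf_
data _→βf_ : Program → Program → Set where
  βv : ∀ C t v E → IsValue v →
       ⟨ plug C (app (lam t) v) , E ⟩ →βf ⟨ plug C (t ⟦ v ⟧) , E ⟩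
  -- the bound variable of the abstraction is chosen (up to α) as a name x
  -- fresh for the whole program
  βi : ∀ C t i (ii : IsInert i) E x →
       x ∉ names ⟨ plug C (app (lam t) i) , E ⟩ →
       ⟨ plug C (app (lam t) i) , E ⟩ →βf ⟨ plug C (t ^ x) , (x , (i , ii)) ∷ E ⟩

-- Multi types. Multisets are lists up to permutation; equality of types is
-- the induced (nested) multiset equality _≈M_.

infixr 5 _⊸_
data LTy : Set where
  _⊸_ : List LTy → List LTy → LTy

MTy : Set
MTy = List LTy

data _≈L_ : LTy → LTy → Set
data _≈M_ : MTy → MTy → Set

data _≈L_ where
  ⊸-cong : ∀ {M M' N N'} → M ≈M M' → N ≈M N' → (M ⊸ N) ≈L (M' ⊸ N')

data _≈M_ where
  []≈   : [] ≈M []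
  _∷≈_  : ∀ {l l' M M'} → l ≈L l' → M ≈M M' → (l ∷ M) ≈M (l' ∷ M')
  swap≈ : ∀ l l' M → (l ∷ l' ∷ M) ≈M (l' ∷ l ∷ M)
  trans≈ : ∀ {M N O} → M ≈M N → N ≈M O → M ≈M O

Ctx : Set
Ctx = Var → MTy

_≈C_ : Ctx → Ctx → Set
Γ ≈C Δ = ∀ x → Γ x ≈M Δ x

∅C : Ctx
∅C _ = []

_⊎C_ : Ctx → Ctx → Ctx
(Γ ⊎C Δ) x = Γ x ++ Δ x

_∶∶_ : Var → MTy → Ctx
(x ∶∶ M) y = if does (y ≟ x) then M else []

-- Γ , x : M   (used only when x ∉ dom Γ, i.e. Γ x ≡ [])
_,,_∶∶_ : Ctx → Var → MTy → Ctx
(Γ ,, x ∶∶ M) y = if does (y ≟ x) then M else Γ y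

-- Typing derivations.  Conclusions are stated up to multiset equality of
-- contexts (≈C) and types are matched up to ≈M, as multisets.

infix 3 _⊢_∶_
data _⊢_∶_ : Ctx → Tm 0 → MTy → Set
data LamPrems (t : Tm 1) : Ctx → MTy → Set

data _⊢_∶_ where
  ax  : ∀ {Γ x M} → Γ ≈C (x ∶∶ M) → Γ ⊢ fv x ∶ M
  app : ∀ {Θ Γ Δ t u M M' N} →
        Γ ⊢ t ∶ [ M ⊸ N ] → Δ ⊢ u ∶ M' → M ≈M M' → Θ ≈C (Γ ⊎C Δ) →
        Θ ⊢ app t u ∶ N
  lam : ∀ {Θ Γ t A} → LamPrems t Γ A → Θ ≈C Γ → Θ ⊢ lam t ∶ A

data LamPrems t where
  []  : LamPrems t ∅C []
  cons : ∀ {Γk Mk Nk Γ A} (x : Var) → x ∉ fvs t → Γk x ≡ [] →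
         (Γk ,, x ∶∶ Mk) ⊢ t ^ x ∶ Nk → LamPrems t Γ A →
         LamPrems t (Γk ⊎C Γ) ((Mk ⊸ Nk) ∷ A)

infix 3 _⊩_∶_
data _⊩_∶_ : Ctx → Program → MTy → Set where
  esε : ∀ {Θ Γ t M} → Γ ⊢ t ∶ M → Θ ≈C Γ → Θ ⊩ ⟨ t , [] ⟩ ∶ M
  es-app : ∀ {Θ Γ Δ t E E' x i M M' N} →
        Γ x ≡ [] → (Γ ,, x ∶∶ M) ⊩ ⟨ t , E ⟩ ∶ N → Δ ⊢ proj₁ i ∶ M' → M ≈M M' →
        E' ≡ E ++ [ (x , i) ] → Θ ≈C (Γ ⊎C Δ) →
        Θ ⊩ ⟨ t , E' ⟩ ∶ N

size   : ∀ {Γ t M} → Γ ⊢ t ∶ M → ℕ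
sizeLP : ∀ {t Γ A} → LamPrems t Γ A → ℕ

size (ax _)            = 0
size (app π ρ _ _)     = suc (size π + size ρ)
size (lam ps _)        = sizeLP ps

sizeLP []                = 0
sizeLP (cons _ _ _ π ps) = size π + sizeLP ps

sizeP : ∀ {Γ p M} → Γ ⊩ p ∶ M → ℕ
sizeP (esε π _)             = size π
sizeP (es-app _ π ρ _ _ _)     = sizeP π + size ρ

{-
A βv or βi step at the root removes exactly the (@) rule typing the redex
(λx.t)u, whose function part has type [M ⊸ N] and hence a single premise.
For βv the body and argument derivations are recombined by the substitution
lemma, which creates no (@) rule: a value typed by a multiset splits into
derivations of its parts (an abstraction through its (λ) premises, a variable
through (ax)), each part is plugged in at one axiom for x, and the empty
multiset costs nothing.  For βi the argument derivation is moved unchanged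
into the new environment entry by (es_@).  Right evaluation contexts and
environments are typed around the redex, so both steps lift to programs.
-}
module Submission where

open import Defs
open import Algebra.Bundles using (CommutativeMonoid)
import Algebra.Properties.CommutativeSemigroup as CommSemigroupProperties
open import Data.Bool using (if_then_else_)
open import Data.Fin using (Fin; zero; suc)
open import Data.List using (List; []; _∷_; _++_; concat; length; map)
open import Data.List.Membership.Propositional using (_∈_; _∉_)
open import Data.List.Membership.Propositional.Properties using (∈-++⁺ˡ; ∈-++⁺ʳ; ∈-++⁻; ∈-map⁻)
open import Data.List.Properties using (++-assoc; ++-identityʳ; ++-conicalˡ; ++-conicalʳ; map-++; concat-++)
open import Data.List.Relation.Binary.Permutation.Propositional using (_↭_; prep; swap)
  renaming (refl to ↭-refl; trans to ↭-trans)
import Data.List.Relation.Binary.Permutation.Propositional.Properties as ↭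
open import Data.List.Relation.Binary.Pointwise as Pointwise using (Pointwise; []; _∷_)
open import Data.List.Relation.Unary.Any using (here; there)
open import Data.Nat using (ℕ; zero; suc; _+_; _<_; _≤_; _∸_; _⊔_; z≤n; s≤s; _≟_)
open import Data.Nat.ListAction using (sum)
open import Data.Nat.Properties
open import Data.Product using (Σ; ∃; _×_; _,_; proj₁; proj₂)
open import Data.Sum as Sum using (_⊎_; inj₁; inj₂; [_,_])
open import Function using (_∘_)
open import Relation.Nullary using (yes; no; does)
open import Relation.Nullary.Decidable using (dec-true; dec-false)
open import Relation.Binary.PropositionalEquality
  using (_≡_; _≢_; refl; sym; trans; cong; cong₂; subst; module ≡-Reasoning)

module ℕ+ = CommSemigroupProperties +-commutativeSemigroup
module ++↭ = CommSemigroupProperties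
  (CommutativeMonoid.commutativeSemigroup (↭.++-commutativeMonoid {A = LTy}))

-- Multisets of linear types

≈L-refl : ∀ {l} → l ≈L l
≈M-refl : ∀ {M} → M ≈M M
≈L-refl {M ⊸ N} = ⊸-cong ≈M-refl ≈M-refl
≈M-refl {[]}    = []≈
≈M-refl {l ∷ M} = ≈L-refl ∷≈ ≈M-refl

≈L-sym : ∀ {l l'} → l ≈L l' → l' ≈L l
≈M-sym : ∀ {M N} → M ≈M N → N ≈M M
≈L-sym (⊸-cong M≈ N≈) = ⊸-cong (≈M-sym M≈) (≈M-sym N≈)
≈M-sym []≈            = []≈
≈M-sym (l≈ ∷≈ M≈)     = ≈L-sym l≈ ∷≈ ≈M-sym M≈
≈M-sym (swap≈ l l' M) = swap≈ l' l M
≈M-sym (trans≈ p q)   = trans≈ (≈M-sym q) (≈M-sym p)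

≈L-trans : ∀ {l l' l''} → l ≈L l' → l' ≈L l'' → l ≈L l''
≈L-trans (⊸-cong p q) (⊸-cong p' q') = ⊸-cong (trans≈ p p') (trans≈ q q')

≡⇒≈M : ∀ {M N} → M ≡ N → M ≈M N
≡⇒≈M refl = ≈M-refl

↭⇒≈M : ∀ {M N} → M ↭ N → M ≈M N
↭⇒≈M ↭-refl       = ≈M-refl
↭⇒≈M (prep l p)   = ≈L-refl ∷≈ ↭⇒≈M p
↭⇒≈M (swap l l' p) = trans≈ (swap≈ l l' _) (≈L-refl ∷≈ (≈L-refl ∷≈ ↭⇒≈M p))
↭⇒≈M (↭-trans p q) = trans≈ (↭⇒≈M p) (↭⇒≈M q)

++⁺ʳ-≈M : ∀ {A A'} B → A ≈M A' → (A ++ B) ≈M (A' ++ B)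
++⁺ʳ-≈M B []≈            = ≈M-refl
++⁺ʳ-≈M B (l≈ ∷≈ p)      = l≈ ∷≈ ++⁺ʳ-≈M B p
++⁺ʳ-≈M B (swap≈ l l' M) = swap≈ l l' (M ++ B)
++⁺ʳ-≈M B (trans≈ p q)   = trans≈ (++⁺ʳ-≈M B p) (++⁺ʳ-≈M B q)

++⁺ˡ-≈M : ∀ A {B B'} → B ≈M B' → (A ++ B) ≈M (A ++ B')
++⁺ˡ-≈M []      p = p
++⁺ˡ-≈M (l ∷ A) p = ≈L-refl ∷≈ ++⁺ˡ-≈M A p

++⁺-≈M : ∀ {A A' B B'} → A ≈M A' → B ≈M B' → (A ++ B) ≈M (A' ++ B')
++⁺-≈M {A' = A'} {B} p q = trans≈ (++⁺ʳ-≈M B p) (++⁺ˡ-≈M A' q)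

≈M-length : ∀ {M N} → M ≈M N → length M ≡ length N
≈M-length []≈            = refl
≈M-length (_ ∷≈ p)       = cong suc (≈M-length p)
≈M-length (swap≈ _ _ _)  = refl
≈M-length (trans≈ p q)   = trans (≈M-length p) (≈M-length q)

≈M-[] : ∀ {M} → M ≈M [] → M ≡ []
≈M-[] {[]}    _ = refl
≈M-[] {_ ∷ _} p with () ← ≈M-length p

↭-Pointwise-commute : ∀ {a ℓ} {A : Set a} {R : A → A → Set ℓ} {xs ys zs : List A} →
  xs ↭ ys → Pointwise R ys zs → ∃ λ ws → Pointwise R xs ws × ws ↭ zs
↭-Pointwise-commute ↭-refl rs = _ , rs , ↭-refl
↭-Pointwise-commute (prep x p) (r ∷ rs) with ↭-Pointwise-commute p rs
... | ws , rs' , p' = _ , r ∷ rs' , prep _ p'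
↭-Pointwise-commute (swap x y p) (r ∷ r' ∷ rs) with ↭-Pointwise-commute p rs
... | ws , rs' , p' = _ , r' ∷ r ∷ rs' , swap _ _ p'
↭-Pointwise-commute (↭-trans p q) rs with ↭-Pointwise-commute q rs
... | ws , rs' , q' with ↭-Pointwise-commute p rs'
... | vs , rs'' , p' = vs , rs'' , ↭-trans p' q'

≈M⇒Pointwise-↭ : ∀ {M N} → M ≈M N → ∃ λ K → Pointwise _≈L_ M K × K ↭ N
≈M⇒Pointwise-↭ []≈ = [] , [] , ↭-refl
≈M⇒Pointwise-↭ (l≈ ∷≈ p) with ≈M⇒Pointwise-↭ p
... | K , rs , q = _ , l≈ ∷ rs , prep _ q
≈M⇒Pointwise-↭ (swap≈ l l' M) = _ , Pointwise.refl ≈L-refl , swap l l' ↭-refl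
≈M⇒Pointwise-↭ (trans≈ p q) with ≈M⇒Pointwise-↭ p | ≈M⇒Pointwise-↭ q
... | K , rs , p' | K' , rs' , q' with ↭-Pointwise-commute p' rs'
... | K'' , rs'' , p'' = K'' , Pointwise.transitive ≈L-trans rs rs'' , ↭-trans p'' q'

-- Type contexts

≈C-refl : ∀ {Γ} → Γ ≈C Γ
≈C-refl _ = ≈M-refl

≈C-sym : ∀ {Γ Δ} → Γ ≈C Δ → Δ ≈C Γ
≈C-sym p y = ≈M-sym (p y)

≈C-trans : ∀ {Γ Δ Θ} → Γ ≈C Δ → Δ ≈C Θ → Γ ≈C Θ
≈C-trans p q y = trans≈ (p y) (q y)

⊎C-cong : ∀ {Γ Γ' Δ Δ'} → Γ ≈C Γ' → Δ ≈C Δ' → (Γ ⊎C Δ) ≈C (Γ' ⊎C Δ')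
⊎C-cong p q y = ++⁺-≈M (p y) (q y)

⊎C-comm : ∀ Γ Δ → (Γ ⊎C Δ) ≈C (Δ ⊎C Γ)
⊎C-comm Γ Δ y = ↭⇒≈M (↭.++-comm (Γ y) (Δ y))

⊎C-assoc : ∀ Γ Δ Θ → ((Γ ⊎C Δ) ⊎C Θ) ≈C (Γ ⊎C (Δ ⊎C Θ))
⊎C-assoc Γ Δ Θ y = ≡⇒≈M (++-assoc (Γ y) (Δ y) (Θ y))

⊎C-identityʳ : ∀ Γ → (Γ ⊎C ∅C) ≈C Γ
⊎C-identityʳ Γ y = ≡⇒≈M (++-identityʳ (Γ y))

⊎C-left-comm : ∀ Γ Δ Θ → (Γ ⊎C (Δ ⊎C Θ)) ≈C (Δ ⊎C (Γ ⊎C Θ))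
⊎C-left-comm Γ Δ Θ y = ↭⇒≈M (++↭.x∙yz≈y∙xz (Γ y) (Δ y) (Θ y))

⊎C-right-comm : ∀ Γ Δ Θ → ((Γ ⊎C Δ) ⊎C Θ) ≈C ((Γ ⊎C Θ) ⊎C Δ)
⊎C-right-comm Γ Δ Θ y = ↭⇒≈M (++↭.xy∙z≈xz∙y (Γ y) (Δ y) (Θ y))

⊎C-interchange : ∀ Γ Δ Θ Φ → ((Γ ⊎C Δ) ⊎C (Θ ⊎C Φ)) ≈C ((Γ ⊎C Θ) ⊎C (Δ ⊎C Φ))
⊎C-interchange Γ Δ Θ Φ y = ↭⇒≈M (++↭.interchange (Γ y) (Δ y) (Θ y) (Φ y))

,,-here : ∀ Γ x M → (Γ ,, x ∶∶ M) x ≡ M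
,,-here Γ x M rewrite dec-true (x ≟ x) refl = refl

,,-there : ∀ Γ x M {y} → y ≢ x → (Γ ,, x ∶∶ M) y ≡ Γ y
,,-there Γ x M {y} y≢x rewrite dec-false (y ≟ x) y≢x = refl

,,-cong : ∀ {Γ Γ'} x {A B} → Γ ≈C Γ' → A ≈M B → (Γ ,, x ∶∶ A) ≈C (Γ' ,, x ∶∶ B)
,,-cong {Γ} {Γ'} x {A} {B} p q y with y ≟ x
... | yes refl rewrite ,,-here Γ y A | ,,-here Γ' y B = q
... | no y≢x   rewrite ,,-there Γ x A y≢x | ,,-there Γ' x B y≢x = p y

∶∶-here : ∀ x M → (x ∶∶ M) x ≡ M
∶∶-here = ,,-here ∅C

∶∶-there : ∀ x M {y} → y ≢ x → (x ∶∶ M) y ≡ []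
∶∶-there = ,,-there ∅C

∶∶-cong : ∀ x {A B} → A ≈M B → (x ∶∶ A) ≈C (x ∶∶ B)
∶∶-cong x = ,,-cong x ≈C-refl

∶∶-[] : ∀ x → (x ∶∶ []) ≈C ∅C
∶∶-[] x y with y ≟ x
... | yes refl rewrite ∶∶-here y [] = []≈
... | no y≢x   rewrite ∶∶-there x [] y≢x = []≈

∶∶-++ : ∀ x A B → (x ∶∶ (A ++ B)) ≈C ((x ∶∶ A) ⊎C (x ∶∶ B))
∶∶-++ x A B y with y ≟ x
... | yes refl rewrite ∶∶-here y (A ++ B) | ∶∶-here y A | ∶∶-here y B = ≈M-refl
... | no y≢x   rewrite ∶∶-there x (A ++ B) y≢x | ∶∶-there x A y≢x | ∶∶-there x B y≢x = []≈

,,-comm : ∀ Γ {x w} A B → w ≢ x → ((Γ ,, x ∶∶ A) ,, w ∶∶ B) ≈C ((Γ ,, w ∶∶ B) ,, x ∶∶ A)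
,,-comm Γ {x} {w} A B w≢x y with y ≟ w | y ≟ x
... | yes refl | _ rewrite ,,-here (Γ ,, x ∶∶ A) y B | ,,-there (Γ ,, y ∶∶ B) x A w≢x
                        | ,,-here Γ y B = ≈M-refl
... | no y≢w | yes refl rewrite ,,-there (Γ ,, y ∶∶ A) w B y≢w | ,,-here Γ y A
                        | ,,-here (Γ ,, w ∶∶ B) y A = ≈M-refl
... | no y≢w | no y≢x rewrite ,,-there (Γ ,, x ∶∶ A) w B y≢w | ,,-there Γ x A y≢x
                        | ,,-there (Γ ,, w ∶∶ B) x A y≢x | ,,-there Γ w B y≢w = ≈M-refl

⊎C-,,ˡ : ∀ Γ Δ x M → Δ x ≡ [] → ((Γ ⊎C Δ) ,, x ∶∶ M) ≈C ((Γ ,, x ∶∶ M) ⊎C Δ)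
⊎C-,,ˡ Γ Δ x M Δ[x] y with y ≟ x
... | yes refl rewrite ,,-here (Γ ⊎C Δ) y M | ,,-here Γ y M | Δ[x] = ≡⇒≈M (sym (++-identityʳ M))
... | no y≢x   rewrite ,,-there (Γ ⊎C Δ) x M y≢x | ,,-there Γ x M y≢x = ≈M-refl

⊎C-,,ʳ : ∀ Γ Δ x M → Γ x ≡ [] → ((Γ ⊎C Δ) ,, x ∶∶ M) ≈C (Γ ⊎C (Δ ,, x ∶∶ M))
⊎C-,,ʳ Γ Δ x M Γ[x] =
  ≈C-trans (,,-cong x (⊎C-comm Γ Δ) ≈M-refl) (≈C-trans (⊎C-,,ˡ Δ Γ x M Γ[x]) (⊎C-comm _ Γ))

_∖_ : Ctx → Var → Ctx
Γ ∖ x = Γ ,, x ∶∶ []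

∖-⊎C : ∀ {Γ Γ₁ Γ₂} x → Γ ≈C (Γ₁ ⊎C Γ₂) → (Γ ∖ x) ≈C ((Γ₁ ∖ x) ⊎C (Γ₂ ∖ x))
∖-⊎C {Γ} {Γ₁} {Γ₂} x p y with y ≟ x
... | yes refl rewrite ,,-here Γ y [] | ,,-here Γ₁ y [] | ,,-here Γ₂ y [] = []≈
... | no y≢x   rewrite ,,-there Γ x [] y≢x | ,,-there Γ₁ x [] y≢x | ,,-there Γ₂ x [] y≢x = p y

∖-∶∶ : ∀ {Γ} x A → Γ ≈C (x ∶∶ A) → (Γ ∖ x) ≈C ∅C
∖-∶∶ {Γ} x A p y with y ≟ x
... | yes refl rewrite ,,-here Γ y [] = []≈
... | no y≢x   rewrite ,,-there Γ x [] y≢x = trans≈ (p y) (≡⇒≈M (∶∶-there x A y≢x))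

∖-∶∶-≢ : ∀ {Γ} x y A → Γ ≈C (y ∶∶ A) → y ≢ x → (Γ ∖ x) ≈C (y ∶∶ A)
∖-∶∶-≢ {Γ} x y A p y≢x z with z ≟ x
... | yes refl rewrite ,,-here Γ z [] | ∶∶-there y A (λ z≡y → y≢x (sym z≡y)) = []≈
... | no z≢x   rewrite ,,-there Γ x [] z≢x = p z

,,-∖ : ∀ Γ x M → Γ x ≡ [] → Γ ≈C ((Γ ,, x ∶∶ M) ∖ x)
,,-∖ Γ x M Γ[x] y with y ≟ x
... | yes refl rewrite ,,-here (Γ ,, y ∶∶ M) y [] | Γ[x] = []≈
... | no y≢x   rewrite ,,-there (Γ ,, x ∶∶ M) x [] y≢x | ,,-there Γ x M y≢x = ≈M-refl

exts-cong : ∀ {m n} {σ τ : Fin m → Tm n} → (∀ i → σ i ≡ τ i) → ∀ i → exts σ i ≡ exts τ i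
exts-cong p zero    = refl
exts-cong p (suc i) = cong (ren suc) (p i)

sub-cong : ∀ {m n} {σ τ : Fin m → Tm n} → (∀ i → σ i ≡ τ i) → ∀ t → sub σ t ≡ sub τ t
sub-cong p (bv i)    = p i
sub-cong p (fv x)    = refl
sub-cong p (lam t)   = cong lam (sub-cong (exts-cong p) t)
sub-cong p (app t u) = cong₂ app (sub-cong p t) (sub-cong p u)

ren-ren : ∀ {k m n} (ρ : Fin m → Fin n) (ρ' : Fin k → Fin m) (ρ'' : Fin k → Fin n) →
  (∀ i → ρ (ρ' i) ≡ ρ'' i) → ∀ t → ren ρ (ren ρ' t) ≡ ren ρ'' t
ren-ren ρ ρ' ρ'' p (bv i)    = cong bv (p i)
ren-ren ρ ρ' ρ'' p (fv x)    = refl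
ren-ren ρ ρ' ρ'' p (lam t)   = cong lam (ren-ren (ext ρ) (ext ρ') (ext ρ'') ext-p t)
  where ext-p : ∀ i → ext ρ (ext ρ' i) ≡ ext ρ'' i
        ext-p zero    = refl
        ext-p (suc i) = cong suc (p i)
ren-ren ρ ρ' ρ'' p (app t u) = cong₂ app (ren-ren ρ ρ' ρ'' p t) (ren-ren ρ ρ' ρ'' p u)

ren-id : ∀ {n} (ρ : Fin n → Fin n) → (∀ i → ρ i ≡ i) → ∀ t → ren ρ t ≡ t
ren-id ρ p (bv i)    = cong bv (p i)
ren-id ρ p (fv x)    = refl
ren-id ρ p (lam t)   = cong lam (ren-id (ext ρ) ext-p t)
  where ext-p : ∀ i → ext ρ i ≡ i
        ext-p zero    = refl
        ext-p (suc i) = cong suc (p i)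
ren-id ρ p (app t u) = cong₂ app (ren-id ρ p t) (ren-id ρ p u)

sub-ren : ∀ {k m n} (σ : Fin m → Tm n) (ρ : Fin k → Fin m) (ρ' : Fin k → Fin n) →
  (∀ i → σ (ρ i) ≡ bv (ρ' i)) → ∀ t → sub σ (ren ρ t) ≡ ren ρ' t
sub-ren σ ρ ρ' p (bv i)    = p i
sub-ren σ ρ ρ' p (fv x)    = refl
sub-ren σ ρ ρ' p (lam t)   = cong lam (sub-ren (exts σ) (ext ρ) (ext ρ') exts-p t)
  where exts-p : ∀ i → exts σ (ext ρ i) ≡ bv (ext ρ' i)
        exts-p zero    = refl
        exts-p (suc i) = cong (ren suc) (p i)
sub-ren σ ρ ρ' p (app t u) = cong₂ app (sub-ren σ ρ ρ' p t) (sub-ren σ ρ ρ' p u)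

-- Free names and transpositions

fvs-ren : ∀ {m n} (ρ : Fin m → Fin n) t → fvs (ren ρ t) ≡ fvs t
fvs-ren ρ (bv i)    = refl
fvs-ren ρ (fv x)    = refl
fvs-ren ρ (lam t)   = fvs-ren (ext ρ) t
fvs-ren ρ (app t u) = cong₂ _++_ (fvs-ren ρ t) (fvs-ren ρ u)

fvs-sub : ∀ {m n} (σ : Fin m → Tm n) t {y} →
  y ∈ fvs (sub σ t) → y ∈ fvs t ⊎ ∃ λ i → y ∈ fvs (σ i)
fvs-sub σ (bv i) p = inj₂ (i , p)
fvs-sub σ (fv x) p = inj₁ p
fvs-sub σ (lam t) p with fvs-sub (exts σ) t p
... | inj₁ q           = inj₁ q
... | inj₂ (suc i , q) = inj₂ (i , subst (_ ∈_) (fvs-ren suc (σ i)) q)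
fvs-sub σ (app t u) p with ∈-++⁻ (fvs (sub σ t)) p
... | inj₁ q = Sum.map₁ ∈-++⁺ˡ (fvs-sub σ t q)
... | inj₂ q = Sum.map₁ (∈-++⁺ʳ (fvs t)) (fvs-sub σ u q)

fvs-open : ∀ (s : Tm 1) z {y} → y ∈ fvs (s ^ z) → y ∈ fvs s ⊎ y ≡ z
fvs-open s z p with fvs-sub (σ₀ (fv z)) s p
... | inj₁ q                   = inj₁ q
... | inj₂ (zero , here y≡z) = inj₂ y≡z

∈-sum-≤ : ∀ {y L} → y ∈ L → y ≤ sum L
∈-sum-≤ {L = l ∷ L} (here refl) = m≤m+n l (sum L)
∈-sum-≤ {L = l ∷ L} (there p)   = ≤-trans (∈-sum-≤ p) (m≤n+m (sum L) l)

freshFor : List Var → Var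
freshFor L = suc (sum L)

freshFor-∉ : ∀ L → freshFor L ∉ L
freshFor-∉ L p = 1+n≰n (∈-sum-≤ p)

swapVar : Var → Var → Var → Var
swapVar a b y = if does (y ≟ a) then b else if does (y ≟ b) then a else y

swapVar-left : ∀ a b → swapVar a b a ≡ b
swapVar-left a b rewrite dec-true (a ≟ a) refl = refl

swapVar-right : ∀ a b → swapVar a b b ≡ a
swapVar-right a b with b ≟ a
... | yes refl rewrite dec-true (b ≟ b) refl = refl
... | no b≢a   rewrite dec-false (b ≟ a) b≢a | dec-true (b ≟ b) refl = refl

swapVar-other : ∀ a b {y} → y ≢ a → y ≢ b → swapVar a b y ≡ y
swapVar-other a b {y} y≢a y≢b rewrite dec-false (y ≟ a) y≢a | dec-false (y ≟ b) y≢b = refl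

swapVar-involutive : ∀ a b y → swapVar a b (swapVar a b y) ≡ y
swapVar-involutive a b y with y ≟ a | y ≟ b
... | yes refl | _ rewrite swapVar-left y b = swapVar-right y b
... | no _ | yes refl rewrite swapVar-right a y = swapVar-left a y
... | no y≢a | no y≢b rewrite swapVar-other a b y≢a y≢b = swapVar-other a b y≢a y≢b

swapVar-injective : ∀ a b {y y'} → swapVar a b y ≡ swapVar a b y' → y ≡ y'
swapVar-injective a b {y} {y'} p = begin
  y                               ≡⟨ sym (swapVar-involutive a b y) ⟩
  swapVar a b (swapVar a b y)     ≡⟨ cong (swapVar a b) p ⟩
  swapVar a b (swapVar a b y')    ≡⟨ swapVar-involutive a b y' ⟩
  y'                              ∎
  where open ≡-Reasoning

swapTm : ∀ {n} → Var → Var → Tm n → Tm n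
swapTm a b (bv i)    = bv i
swapTm a b (fv x)    = fv (swapVar a b x)
swapTm a b (lam t)   = lam (swapTm a b t)
swapTm a b (app t u) = app (swapTm a b t) (swapTm a b u)

swapTm-ren : ∀ {m n} a b (ρ : Fin m → Fin n) t → swapTm a b (ren ρ t) ≡ ren ρ (swapTm a b t)
swapTm-ren a b ρ (bv i)    = refl
swapTm-ren a b ρ (fv x)    = refl
swapTm-ren a b ρ (lam t)   = cong lam (swapTm-ren a b (ext ρ) t)
swapTm-ren a b ρ (app t u) = cong₂ app (swapTm-ren a b ρ t) (swapTm-ren a b ρ u)

swapTm-sub : ∀ {m n} a b (σ : Fin m → Tm n) t →
  swapTm a b (sub σ t) ≡ sub (swapTm a b ∘ σ) (swapTm a b t)
swapTm-sub a b σ (bv i)    = refl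
swapTm-sub a b σ (fv x)    = refl
swapTm-sub a b σ (lam t)   =
  cong lam (trans (swapTm-sub a b (exts σ) t) (sub-cong exts-swap (swapTm a b t)))
  where exts-swap : ∀ i → swapTm a b (exts σ i) ≡ exts (swapTm a b ∘ σ) i
        exts-swap zero    = refl
        exts-swap (suc i) = swapTm-ren a b suc (σ i)
swapTm-sub a b σ (app t u) = cong₂ app (swapTm-sub a b σ t) (swapTm-sub a b σ u)

swapTm-open : ∀ a b (s : Tm 1) z → swapTm a b (s ^ z) ≡ swapTm a b s ^ swapVar a b z
swapTm-open a b s z = trans (swapTm-sub a b (σ₀ (fv z)) s) (sub-cong (λ { zero → refl }) (swapTm a b s))

fvs-swapTm : ∀ {n} a b (t : Tm n) → fvs (swapTm a b t) ≡ map (swapVar a b) (fvs t)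
fvs-swapTm a b (bv i)    = refl
fvs-swapTm a b (fv x)    = refl
fvs-swapTm a b (lam t)   = fvs-swapTm a b t
fvs-swapTm a b (app t u) =
  trans (cong₂ _++_ (fvs-swapTm a b t) (fvs-swapTm a b u)) (sym (map-++ (swapVar a b) (fvs t) (fvs u)))

swapTm-fresh : ∀ {n} a b (t : Tm n) → a ∉ fvs t → b ∉ fvs t → swapTm a b t ≡ t
swapTm-fresh a b (bv i) _ _ = refl
swapTm-fresh a b (fv x) a∉ b∉ =
  cong fv (swapVar-other a b (λ x≡a → a∉ (here (sym x≡a))) (λ x≡b → b∉ (here (sym x≡b))))
swapTm-fresh a b (lam t) a∉ b∉ = cong lam (swapTm-fresh a b t a∉ b∉)
swapTm-fresh a b (app t u) a∉ b∉ =
  cong₂ app (swapTm-fresh a b t (a∉ ∘ ∈-++⁺ˡ) (b∉ ∘ ∈-++⁺ˡ))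
            (swapTm-fresh a b u (a∉ ∘ ∈-++⁺ʳ (fvs t)) (b∉ ∘ ∈-++⁺ʳ (fvs t)))

swapTm-∉ : ∀ {n} a b (t : Tm n) {z} → z ∉ fvs t → swapVar a b z ∉ fvs (swapTm a b t)
swapTm-∉ a b t z∉ p with ∈-map⁻ (swapVar a b) (subst (_ ∈_) (fvs-swapTm a b t) p)
... | y , y∈ , z≡y = z∉ (subst (_∈ fvs t) (sym (swapVar-injective a b z≡y)) y∈)

-- Substituting for a free name

wk : ∀ {n} → Tm 0 → Tm n
wk = ren (λ ())

_[_≔_] : ∀ {n} → Tm n → Var → Tm 0 → Tm n
bv i      [ x ≔ v ] = bv i
fv y      [ x ≔ v ] = if does (y ≟ x) then wk v else fv y
lam t     [ x ≔ v ] = lam (t [ x ≔ v ])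
app t u   [ x ≔ v ] = app (t [ x ≔ v ]) (u [ x ≔ v ])

≔-here : ∀ x v → fv x [ x ≔ v ] ≡ v
≔-here x v rewrite dec-true (x ≟ x) refl = ren-id (λ ()) (λ ()) v

≔-there : ∀ {n} x v {y} → y ≢ x → fv {n} y [ x ≔ v ] ≡ fv y
≔-there x v {y} y≢x rewrite dec-false (y ≟ x) y≢x = refl

≔-ren : ∀ {m n} x v (ρ : Fin m → Fin n) t → ren ρ t [ x ≔ v ] ≡ ren ρ (t [ x ≔ v ])
≔-ren x v ρ (bv i) = refl
≔-ren x v ρ (fv y) with y ≟ x
... | yes refl rewrite dec-true (y ≟ y) refl = sym (ren-ren ρ (λ ()) (λ ()) (λ ()) v)
... | no y≢x   rewrite dec-false (y ≟ x) y≢x = refl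
≔-ren x v ρ (lam t)   = cong lam (≔-ren x v (ext ρ) t)
≔-ren x v ρ (app t u) = cong₂ app (≔-ren x v ρ t) (≔-ren x v ρ u)

≔-sub : ∀ {m n} x v (σ : Fin m → Tm n) t →
  sub σ t [ x ≔ v ] ≡ sub (λ i → σ i [ x ≔ v ]) (t [ x ≔ v ])
≔-sub x v σ (bv i) = refl
≔-sub x v σ (fv y) with y ≟ x
... | yes refl rewrite dec-true (y ≟ y) refl = sym (sub-ren _ (λ ()) (λ ()) (λ ()) v)
... | no y≢x   rewrite dec-false (y ≟ x) y≢x = refl
≔-sub x v σ (lam t) = cong lam (trans (≔-sub x v (exts σ) t) (sub-cong exts-≔ (t [ x ≔ v ])))
  where exts-≔ : ∀ i → exts σ i [ x ≔ v ] ≡ exts (λ j → σ j [ x ≔ v ]) i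
        exts-≔ zero    = refl
        exts-≔ (suc i) = ≔-ren x v suc (σ i)
≔-sub x v σ (app t u) = cong₂ app (≔-sub x v σ t) (≔-sub x v σ u)

≔-fresh : ∀ {n} x v (t : Tm n) → x ∉ fvs t → t [ x ≔ v ] ≡ t
≔-fresh x v (bv i)    _  = refl
≔-fresh x v (fv y)    x∉ = ≔-there x v (λ y≡x → x∉ (here (sym y≡x)))
≔-fresh x v (lam t)   x∉ = cong lam (≔-fresh x v t x∉)
≔-fresh x v (app t u) x∉ = cong₂ app (≔-fresh x v t (x∉ ∘ ∈-++⁺ˡ)) (≔-fresh x v u (x∉ ∘ ∈-++⁺ʳ (fvs t)))

≔-open : ∀ x v (s : Tm 1) {z} → z ≢ x → (s ^ z) [ x ≔ v ] ≡ (s [ x ≔ v ]) ^ z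
≔-open x v s {z} z≢x =
  trans (≔-sub x v (σ₀ (fv z)) s) (sub-cong (λ { zero → ≔-there x v z≢x }) (s [ x ≔ v ]))

≔-open-self : ∀ x v (s : Tm 1) → x ∉ fvs s → (s ^ x) [ x ≔ v ] ≡ s ⟦ v ⟧
≔-open-self x v s x∉ = begin
  (s ^ x) [ x ≔ v ]                         ≡⟨ ≔-sub x v (σ₀ (fv x)) s ⟩
  sub (λ i → σ₀ (fv x) i [ x ≔ v ]) (s [ x ≔ v ]) ≡⟨ cong (sub _) (≔-fresh x v s x∉) ⟩
  sub (λ i → σ₀ (fv x) i [ x ≔ v ]) s         ≡⟨ sub-cong (λ { zero → ≔-here x v }) s ⟩
  s ⟦ v ⟧                                   ∎
  where open ≡-Reasoning

fvs-≔ : ∀ {n} x v (t : Tm n) {y} → y ∈ fvs (t [ x ≔ v ]) → y ∈ fvs t ⊎ y ∈ fvs v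
fvs-≔ x v (fv y) p with y ≟ x
... | yes refl rewrite dec-true (y ≟ y) refl = inj₂ (subst (_ ∈_) (fvs-ren (λ ()) v) p)
... | no y≢x   rewrite dec-false (y ≟ x) y≢x = inj₁ p
fvs-≔ x v (lam t) p = fvs-≔ x v t p
fvs-≔ x v (app t u) p with ∈-++⁻ (fvs (t [ x ≔ v ])) p
... | inj₁ q = Sum.map₁ ∈-++⁺ˡ (fvs-≔ x v t q)
... | inj₂ q = Sum.map₁ (∈-++⁺ʳ (fvs t)) (fvs-≔ x v u q)

-- Typing derivations

height   : ∀ {Γ t M} → Γ ⊢ t ∶ M → ℕ
heightLP : ∀ {t Γ A} → LamPrems t Γ A → ℕ
height (ax _)                = 0
height (app π ρ _ _)         = suc (height π ⊔ height ρ)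
height (lam ps _)            = suc (heightLP ps)
heightLP []                  = 0
heightLP (cons _ _ _ π ps)   = height π ⊔ heightLP ps

_≃_ : ∀ {Γ t A Γ' t' A'} → Γ ⊢ t ∶ A → Γ' ⊢ t' ∶ A' → Set
π ≃ π' = size π ≡ size π' × height π ≡ height π'

⊢-cast : ∀ {Γ Γ' t t' A} → t ≡ t' → Γ' ≈C Γ → (π : Γ ⊢ t ∶ A) → Σ (Γ' ⊢ t' ∶ A) (_≃ π)
⊢-cast refl p (ax q)        = ax (≈C-trans p q) , refl , refl
⊢-cast refl p (app π ρ q r) = app π ρ q (≈C-trans p r) , refl , refl
⊢-cast refl p (lam ps q)    = lam ps (≈C-trans p q) , refl , refl

record Prems≈ (s : Tm 1) (Γ : Ctx) (A : MTy) : Set where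
  constructor prems≈
  field
    {ctx}  : Ctx
    ctx≈   : ctx ≈C Γ
    prems  : LamPrems s ctx A
open Prems≈

lam≈ : ∀ {Θ Γ s A} → Prems≈ s Γ A → Θ ≈C Γ → Θ ⊢ lam s ∶ A
lam≈ (prems≈ p ps) q = lam ps (≈C-trans q (≈C-sym p))

relevance   : ∀ {Γ t A} → Γ ⊢ t ∶ A → ∀ {y} → y ∉ fvs t → Γ y ≡ []
relevanceLP : ∀ {s Γ A} → LamPrems s Γ A → ∀ {y} → y ∉ fvs s → Γ y ≡ []
relevance (ax {x = x} p) y∉ = ≈M-[] (trans≈ (p _) (≡⇒≈M (∶∶-there x _ (y∉ ∘ here))))
relevance (app {t = t} π ρ _ p) y∉ =
  ≈M-[] (trans≈ (p _) (≡⇒≈M (cong₂ _++_ (relevance π (y∉ ∘ ∈-++⁺ˡ)) (relevance ρ (y∉ ∘ ∈-++⁺ʳ (fvs t))))))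
relevance (lam ps p) y∉ = ≈M-[] (trans≈ (p _) (≡⇒≈M (relevanceLP ps y∉)))
relevanceLP [] y∉ = refl
relevanceLP {s} (cons {Γk = Γk} {Mk} z _ Γk[z] π ps) {y} y∉ = cong₂ _++_ Γk[y] (relevanceLP ps y∉)
  where
  Γk[y] : Γk y ≡ []
  Γk[y] with y ≟ z
  ... | yes refl = Γk[z]
  ... | no y≢z   = trans (sym (,,-there Γk z Mk y≢z)) (relevance π ([ y∉ , y≢z ] ∘ fvs-open s z))

_≃LP_ : ∀ {s Γ A s' Γ' A'} → LamPrems s Γ A → LamPrems s' Γ' A' → Set
ps ≃LP ps' = sizeLP ps ≡ sizeLP ps' × heightLP ps ≡ heightLP ps'

swapCtx : Var → Var → Ctx → Ctx
swapCtx a b Γ = Γ ∘ swapVar a b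

swapCtx-,, : ∀ a b Γ x M y → swapCtx a b (Γ ,, x ∶∶ M) y ≡ (swapCtx a b Γ ,, swapVar a b x ∶∶ M) y
swapCtx-,, a b Γ x M y with y ≟ swapVar a b x
... | yes refl = begin
  (Γ ,, x ∶∶ M) (swapVar a b (swapVar a b x))        ≡⟨ cong (Γ ,, x ∶∶ M) (swapVar-involutive a b x) ⟩
  (Γ ,, x ∶∶ M) x                                    ≡⟨ ,,-here Γ x M ⟩
  M                                                  ≡⟨ ,,-here (swapCtx a b Γ) (swapVar a b x) M ⟨
  (swapCtx a b Γ ,, swapVar a b x ∶∶ M) (swapVar a b x) ∎
  where open ≡-Reasoning
... | no y≢ = trans (,,-there Γ x M swapped≢x) (sym (,,-there (swapCtx a b Γ) (swapVar a b x) M y≢))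
  where swapped≢x : swapVar a b y ≢ x
        swapped≢x p = y≢ (trans (sym (swapVar-involutive a b y)) (cong (swapVar a b) p))

swapCtx-fresh : ∀ a b Γ → Γ a ≡ [] → Γ b ≡ [] → swapCtx a b Γ ≈C Γ
swapCtx-fresh a b Γ Γ[a] Γ[b] y with y ≟ a | y ≟ b
... | yes refl | _ rewrite swapVar-left y b = ≡⇒≈M (trans Γ[b] (sym Γ[a]))
... | no _ | yes refl rewrite swapVar-right a y = ≡⇒≈M (trans Γ[a] (sym Γ[b]))
... | no y≢a | no y≢b rewrite swapVar-other a b y≢a y≢b = ≈M-refl

⊢-swap  : ∀ a b {Γ t A} (π : Γ ⊢ t ∶ A) → Σ (swapCtx a b Γ ⊢ swapTm a b t ∶ A) (_≃ π)
LP-swap : ∀ a b {s Γ A} (ps : LamPrems s Γ A) →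
  Σ (Prems≈ (swapTm a b s) (swapCtx a b Γ) A) λ ps' → prems ps' ≃LP ps
⊢-swap a b (ax {x = x} {M = M} p) =
  ax (λ y → trans≈ (p (swapVar a b y)) (≡⇒≈M (swapCtx-,, a b ∅C x M y))) , refl , refl
⊢-swap a b (app π ρ q r) with ⊢-swap a b π | ⊢-swap a b ρ
... | π' , sπ , hπ | ρ' , sρ , hρ =
  app π' ρ' q (r ∘ swapVar a b) , cong suc (cong₂ _+_ sπ sρ) , cong suc (cong₂ _⊔_ hπ hρ)
⊢-swap a b (lam ps p) with LP-swap a b ps
... | ps' , sps , hps = lam≈ ps' (p ∘ swapVar a b) , sps , cong suc hps
LP-swap a b [] = prems≈ (λ _ → []≈) [] , refl , refl
LP-swap a b {s} (cons {Γk = Γk} {Mk} z z∉ Γk[z] π ps) with ⊢-swap a b π | LP-swap a b ps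
... | π₁ , sπ , hπ | ps' , sps , hps
    with ⊢-cast (swapTm-open a b s z) (≡⇒≈M ∘ sym ∘ swapCtx-,, a b Γk z Mk) π₁
... | π₂ , sπ₂ , hπ₂ =
  prems≈ (⊎C-cong ≈C-refl (ctx≈ ps'))
         (cons (swapVar a b z) (swapTm-∉ a b s z∉)
               (trans (cong Γk (swapVar-involutive a b z)) Γk[z]) π₂ (prems ps')) ,
  cong₂ _+_ (trans sπ₂ sπ) sps , cong₂ _⊔_ (trans hπ₂ hπ) hps

rename-premise : ∀ {s Γ M N z w} → z ∉ fvs s → Γ z ≡ [] → w ∉ fvs s → Γ w ≡ [] →
  (π : (Γ ,, z ∶∶ M) ⊢ s ^ z ∶ N) → Σ ((Γ ,, w ∶∶ M) ⊢ s ^ w ∶ N) (_≃ π)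
rename-premise {s} {Γ} {M} {z = z} {w} z∉ Γ[z] w∉ Γ[w] π with ⊢-swap z w π
... | π₁ , sπ₁ , hπ₁ with ⊢-cast s^z↦s^w swapped-ctx π₁
  where
  s^z↦s^w : swapTm z w (s ^ z) ≡ s ^ w
  s^z↦s^w = trans (swapTm-open z w s z) (cong₂ _^_ (swapTm-fresh z w s z∉ w∉) (swapVar-left z w))
  swapped-ctx : (Γ ,, w ∶∶ M) ≈C swapCtx z w (Γ ,, z ∶∶ M)
  swapped-ctx y = trans≈ (,,-cong w (≈C-sym (swapCtx-fresh z w Γ Γ[z] Γ[w])) ≈M-refl y)
    (≡⇒≈M (sym (trans (swapCtx-,, z w Γ z M y) (cong (λ u → (swapCtx z w Γ ,, u ∶∶ M) y) (swapVar-left z w)))))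
... | π₂ , sπ₂ , hπ₂ = π₂ , trans sπ₂ sπ₁ , trans hπ₂ hπ₁

LP-resp-↭ : ∀ {s Γ A B} (ps : LamPrems s Γ A) → A ↭ B →
  Σ (Prems≈ s Γ B) λ ps' → sizeLP (prems ps') ≡ sizeLP ps
LP-resp-↭ ps ↭-refl = prems≈ ≈C-refl ps , refl
LP-resp-↭ (cons {Γk = Γk} z z∉ Γk[z] π ps) (prep _ p) with LP-resp-↭ ps p
... | ps' , sps = prems≈ (⊎C-cong ≈C-refl (ctx≈ ps')) (cons z z∉ Γk[z] π (prems ps')) , cong (size π +_) sps
LP-resp-↭ (cons {Γk = Γ₁} z z∉ Γ₁[z] π (cons {Γk = Γ₂} {Γ = Γ₃} z' z'∉ Γ₂[z'] π' ps)) (swap _ _ p)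
  with LP-resp-↭ ps p
... | ps' , sps =
  prems≈ {ctx = Γ₂ ⊎C (Γ₁ ⊎C ctx ps')}
         (≈C-trans (⊎C-cong (≈C-refl {Γ₂}) (⊎C-cong (≈C-refl {Γ₁}) (ctx≈ ps'))) (⊎C-left-comm Γ₂ Γ₁ Γ₃))
         (cons z' z'∉ Γ₂[z'] π' (cons z z∉ Γ₁[z] π (prems ps'))) ,
  trans (cong (λ n → size π' + (size π + n)) sps) (ℕ+.x∙yz≈y∙xz (size π') (size π) (sizeLP ps))
LP-resp-↭ ps (↭-trans p q) with LP-resp-↭ ps p
... | ps₁ , s₁ with LP-resp-↭ (prems ps₁) q
... | ps₂ , s₂ = prems≈ (≈C-trans (ctx≈ ps₂) (ctx≈ ps₁)) (prems ps₂) , trans s₂ s₁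

-- Turning a multiset equality into pointwise conversion followed by a permutation lets
-- type conversion recurse structurally on derivations.
⊢-resp-≈M         : ∀ {Γ t A B} (π : Γ ⊢ t ∶ A) → A ≈M B → Σ (Γ ⊢ t ∶ B) λ π' → size π' ≡ size π
LP-resp-Pointwise : ∀ {s Γ A B} (ps : LamPrems s Γ A) → Pointwise _≈L_ A B →
  Σ (Prems≈ s Γ B) λ ps' → sizeLP (prems ps') ≡ sizeLP ps
⊢-resp-≈M (ax {x = x} p) A≈B = ax (≈C-trans p (∶∶-cong x A≈B)) , refl
⊢-resp-≈M (app π ρ q r) A≈B with ⊢-resp-≈M π (⊸-cong ≈M-refl A≈B ∷≈ []≈)
... | π' , sπ = app π' ρ q r , cong (λ n → suc (n + size ρ)) sπ
⊢-resp-≈M (lam ps p) A≈B with ≈M⇒Pointwise-↭ A≈B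
... | _ , pw , perm with LP-resp-Pointwise ps pw
... | ps₁ , s₁ with LP-resp-↭ (prems ps₁) perm
... | ps₂ , s₂ = lam≈ ps₂ (≈C-trans p (≈C-sym (ctx≈ ps₁))) , trans s₂ s₁
LP-resp-Pointwise [] [] = prems≈ ≈C-refl [] , refl
LP-resp-Pointwise (cons {Γk = Γk} z z∉ Γk[z] π ps) (⊸-cong M≈ N≈ ∷ pw)
  with ⊢-resp-≈M π N≈ | LP-resp-Pointwise ps pw
... | π₁ , sπ | ps' , sps with ⊢-cast refl (,,-cong z ≈C-refl (≈M-sym M≈)) π₁
... | π₂ , sπ₂ , _ =
  prems≈ (⊎C-cong ≈C-refl (ctx≈ ps')) (cons z z∉ Γk[z] π₂ (prems ps')) , cong₂ _+_ (trans sπ₂ sπ) sps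

value-[] : ∀ {Δ v M} → IsValue v → (ρ : Δ ⊢ v ∶ M) → M ≈M [] → Δ ≈C ∅C × size ρ ≡ 0
value-[] iv ρ M≈[] with ⊢-resp-≈M ρ M≈[]
value-[] (var y) ρ _ | ax p , sρ     = ≈C-trans p (∶∶-[] y) , sym sρ
value-[] (abs t) ρ _ | lam [] p , sρ = p , sym sρ

LP-split : ∀ {s Γ} A {B} (ps : LamPrems s Γ (A ++ B)) →
  Σ Ctx λ Γ₁ → Σ Ctx λ Γ₂ → Γ ≈C (Γ₁ ⊎C Γ₂) ×
  Σ (LamPrems s Γ₁ A) λ ps₁ → Σ (LamPrems s Γ₂ B) λ ps₂ → sizeLP ps ≡ sizeLP ps₁ + sizeLP ps₂
LP-split [] ps = ∅C , _ , ≈C-refl , [] , ps , refl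
LP-split (_ ∷ A) (cons {Γk = Γk} z z∉ Γk[z] π ps) with LP-split A ps
... | Γ₁ , Γ₂ , p , ps₁ , ps₂ , sps =
  Γk ⊎C Γ₁ , Γ₂ , ≈C-trans (⊎C-cong ≈C-refl p) (≈C-sym (⊎C-assoc Γk Γ₁ Γ₂)) ,
  cons z z∉ Γk[z] π ps₁ , ps₂ , trans (cong (size π +_) sps) (sym (+-assoc (size π) _ _))

value-split : ∀ {Δ v M} A {B} → IsValue v → (ρ : Δ ⊢ v ∶ M) → M ≈M (A ++ B) →
  Σ Ctx λ Δ₁ → Σ Ctx λ Δ₂ → Δ ≈C (Δ₁ ⊎C Δ₂) ×
  Σ (Δ₁ ⊢ v ∶ A) λ ρ₁ → Σ (Δ₂ ⊢ v ∶ B) λ ρ₂ → size ρ ≡ size ρ₁ + size ρ₂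
value-split A iv ρ M≈ with ⊢-resp-≈M ρ M≈
value-split A {B} (var y) ρ _ | ax p , sρ =
  y ∶∶ A , y ∶∶ B , ≈C-trans p (∶∶-++ y A B) , ax ≈C-refl , ax ≈C-refl , sym sρ
value-split A (abs t) ρ _ | lam ps p , sρ with LP-split A ps
... | Γ₁ , Γ₂ , q , ps₁ , ps₂ , sps =
  Γ₁ , Γ₂ , ≈C-trans p q , lam ps₁ ≈C-refl , lam ps₂ ≈C-refl , trans (sym sρ) sps

-- The substitution lemma

subst-var-here : ∀ {Γ x A v Δ M} → Γ ≈C (x ∶∶ A) → (ρ : Δ ⊢ v ∶ M) → Γ x ≈M M →
  Σ (((Γ ∖ x) ⊎C Δ) ⊢ fv x [ x ≔ v ] ∶ A) λ π → size π ≡ size ρ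
subst-var-here {Γ} {x} {A} {v} p ρ M≈ with ⊢-resp-≈M ρ (trans≈ (≈M-sym M≈) (trans≈ (p x) (≡⇒≈M (∶∶-here x A))))
... | ρ' , sρ' with ⊢-cast (sym (≔-here x v)) (⊎C-cong (∖-∶∶ x A p) ≈C-refl) ρ'
... | π , sπ , _ = π , trans sπ sρ'

subst-var-there : ∀ {Γ x y A v Δ M} → Γ ≈C (y ∶∶ A) → y ≢ x → IsValue v → (ρ : Δ ⊢ v ∶ M) → Γ x ≈M M →
  Σ (((Γ ∖ x) ⊎C Δ) ⊢ fv y [ x ≔ v ] ∶ A) λ π → size π ≡ size ρ
subst-var-there {Γ} {x} {y} {A} {v} {Δ} p y≢x iv ρ M≈
  with value-[] iv ρ (trans≈ (≈M-sym M≈) (trans≈ (p x) (≡⇒≈M (∶∶-there y A (y≢x ∘ sym)))))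
... | Δ≈∅ , sρ with ⊢-cast (sym (≔-there x v y≢x)) ctx-eq (ax {x = y} (≈C-refl {y ∶∶ A}))
  where
  ctx-eq : ((Γ ∖ x) ⊎C Δ) ≈C (y ∶∶ A)
  ctx-eq = ≈C-trans (⊎C-cong (∖-∶∶-≢ x y A p y≢x) Δ≈∅) (⊎C-identityʳ (y ∶∶ A))
... | π , sπ , _ = π , trans sπ (sym sρ)

substitution : ∀ n {Γ t A} (π : Γ ⊢ t ∶ A) → height π < n →
  ∀ x {v Δ M} → IsValue v → (ρ : Δ ⊢ v ∶ M) → Γ x ≈M M →
  Σ (((Γ ∖ x) ⊎C Δ) ⊢ t [ x ≔ v ] ∶ A) λ π' → size π' ≡ size π + size ρ
substitution-LP : ∀ n {s Γ A} (ps : LamPrems s Γ A) → heightLP ps < n →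
  ∀ x {v Δ M} → IsValue v → (ρ : Δ ⊢ v ∶ M) → Γ x ≈M M →
  Σ (Prems≈ (s [ x ≔ v ]) ((Γ ∖ x) ⊎C Δ) A) λ ps' → sizeLP (prems ps') ≡ sizeLP ps + size ρ
substitution-premise : ∀ n {s Γ M N z} (π : (Γ ,, z ∶∶ M) ⊢ s ^ z ∶ N) → height π < n →
  z ∉ fvs s → Γ z ≡ [] → ∀ x {v Δ} → IsValue v → (ρ : Δ ⊢ v ∶ Γ x) →
  Σ Var λ w → w ∉ fvs (s [ x ≔ v ]) × ((Γ ∖ x) ⊎C Δ) w ≡ [] ×
  Σ ((((Γ ∖ x) ⊎C Δ) ,, w ∶∶ M) ⊢ (s [ x ≔ v ]) ^ w ∶ N) λ π' → size π' ≡ size π + size ρ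

substitution (suc n) (ax {x = y} p) _ x iv ρ M≈ with y ≟ x
... | yes refl = subst-var-here p ρ M≈
... | no y≢x   = subst-var-there p y≢x iv ρ M≈
substitution (suc n) (app {Γ = Γ₁} {Δ = Γ₂} π₁ π₂ q p) h x iv ρ M≈
  with value-split (Γ₁ x) iv ρ (trans≈ (≈M-sym M≈) (p x))
... | Δ₁ , Δ₂ , Δ≈ , ρ₁ , ρ₂ , sρ
  with substitution n π₁ (m⊔n<o⇒m<o _ _ (≤-pred h)) x iv ρ₁ ≈M-refl
     | substitution n π₂ (m⊔n<o⇒n<o _ _ (≤-pred h)) x iv ρ₂ ≈M-refl
... | π₁' , s₁ | π₂' , s₂ =
  app π₁' π₂' q (≈C-trans (⊎C-cong (∖-⊎C x p) Δ≈) (⊎C-interchange (Γ₁ ∖ x) (Γ₂ ∖ x) Δ₁ Δ₂)) ,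
  cong suc (begin
    size π₁' + size π₂'                           ≡⟨ cong₂ _+_ s₁ s₂ ⟩
    (size π₁ + size ρ₁) + (size π₂ + size ρ₂)     ≡⟨ ℕ+.interchange (size π₁) (size ρ₁) (size π₂) (size ρ₂) ⟩
    (size π₁ + size π₂) + (size ρ₁ + size ρ₂)     ≡⟨ cong (size π₁ + size π₂ +_) sρ ⟨
    (size π₁ + size π₂) + size ρ                  ∎)
  where open ≡-Reasoning
substitution (suc n) (lam ps p) h x iv ρ M≈ with substitution-LP n ps (≤-pred h) x iv ρ (trans≈ (≈M-sym (p x)) M≈)
... | ps' , sps' = lam≈ ps' (⊎C-cong (,,-cong x p []≈) ≈C-refl) , sps'

substitution-LP n [] _ x iv ρ M≈ with value-[] iv ρ (≈M-sym M≈)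
... | Δ≈∅ , sρ = prems≈ (≈C-sym (⊎C-cong (∶∶-[] x) Δ≈∅)) [] , sym sρ
substitution-LP n {s} (cons {Γk = Γk} {Γ = Γr} z z∉ Γk[z] π ps) h x iv ρ M≈
  with value-split (Γk x) iv ρ (≈M-sym M≈)
... | Δ₁ , Δ₂ , Δ≈ , ρ₁ , ρ₂ , sρ
  with substitution-premise n {s} π (m⊔n<o⇒m<o _ _ h) z∉ Γk[z] x iv ρ₁
     | substitution-LP n ps (m⊔n<o⇒n<o _ _ h) x iv ρ₂ ≈M-refl
... | w , w∉ , ctx[w] , π' , sπ' | ps' , sps' =
  prems≈ (≈C-trans (⊎C-cong (≈C-refl {(Γk ∖ x) ⊎C Δ₁}) (ctx≈ ps'))
         (≈C-trans (⊎C-interchange (Γk ∖ x) Δ₁ (Γr ∖ x) Δ₂)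
                   (⊎C-cong (≈C-sym (∖-⊎C x ≈C-refl)) (≈C-sym Δ≈))))
         (cons w w∉ ctx[w] π' (prems ps')) ,
  (begin
    size π' + sizeLP (prems ps')                    ≡⟨ cong₂ _+_ sπ' sps' ⟩
    (size π + size ρ₁) + (sizeLP ps + size ρ₂)      ≡⟨ ℕ+.interchange (size π) (size ρ₁) (sizeLP ps) (size ρ₂) ⟩
    (size π + sizeLP ps) + (size ρ₁ + size ρ₂)      ≡⟨ cong (size π + sizeLP ps +_) sρ ⟨
    (size π + sizeLP ps) + size ρ                   ∎)
  where open ≡-Reasoning

-- The bound name z of the premise may clash with x or with a name of v, so it is first
-- renamed to a fresh w; renaming preserves the height, hence the induction on height.
substitution-premise n {s} {Γ} {M} {N} {z} π h z∉ Γ[z] x {v} {Δ} iv ρ =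
  w , [ w∉s , w∉v ] ∘ fvs-≔ x v s , cong₂ _++_ (trans (,,-there Γ x [] w≢x) Γ[w]) Δ[w] , premise
  where
  w : Var
  w = freshFor (x ∷ z ∷ fvs s ++ fvs v)
  w-fresh : w ∉ x ∷ z ∷ fvs s ++ fvs v
  w-fresh = freshFor-∉ (x ∷ z ∷ fvs s ++ fvs v)
  w≢x : w ≢ x
  w≢x = w-fresh ∘ here
  w≢z : w ≢ z
  w≢z = w-fresh ∘ there ∘ here
  w∉s : w ∉ fvs s
  w∉s = w-fresh ∘ there ∘ there ∘ ∈-++⁺ˡ
  w∉v : w ∉ fvs v
  w∉v = w-fresh ∘ there ∘ there ∘ ∈-++⁺ʳ (fvs s)
  Γ[w] : Γ w ≡ []
  Γ[w] = trans (sym (,,-there Γ z M w≢z)) (relevance π ([ w∉s , w≢z ] ∘ fvs-open s z))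
  Δ[w] : Δ w ≡ []
  Δ[w] = relevance ρ w∉v
  premise : Σ ((((Γ ∖ x) ⊎C Δ) ,, w ∶∶ M) ⊢ (s [ x ≔ v ]) ^ w ∶ N) λ π' → size π' ≡ size π + size ρ
  premise with rename-premise {s} z∉ Γ[z] w∉s Γ[w] π
  ... | π₁ , sπ₁ , hπ₁
      with substitution n π₁ (subst (_< n) (sym hπ₁) h) x iv ρ (≡⇒≈M (,,-there Γ w M (w≢x ∘ sym)))
  ... | π₂ , sπ₂
      with ⊢-cast (≔-open x v s w≢x)
                  (≈C-trans (⊎C-,,ˡ (Γ ∖ x) Δ w M Δ[w]) (⊎C-cong (,,-comm Γ [] M w≢x) ≈C-refl)) π₂
  ... | π₃ , sπ₃ , _ = π₃ , trans sπ₃ (trans sπ₂ (cong (_+ size ρ) sπ₁))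

-- Evaluation contexts and reduction steps

record PlugSplit (C : ECtx) (Θ : Ctx) (s : Tm 0) (A : MTy) (π : Θ ⊢ plug C s ∶ A) : Set where
  field
    Γ-ctx Γ-hole : Ctx
    A-hole       : MTy
    π-hole       : Γ-hole ⊢ s ∶ A-hole
    ctx-split    : Θ ≈C (Γ-ctx ⊎C Γ-hole)
    size-ctx     : ℕ
    size-split   : size π ≡ size-ctx + size π-hole
    refill       : ∀ {Γ s'} (π' : Γ ⊢ s' ∶ A-hole) →
                   Σ ((Γ-ctx ⊎C Γ) ⊢ plug C s' ∶ A) λ π'' → size π'' ≡ size-ctx + size π'

plug-split : ∀ C {Θ s A} (π : Θ ⊢ plug C s ∶ A) → PlugSplit C Θ s A π
plug-split hole π = record
  { Γ-ctx = ∅C ; π-hole = π ; ctx-split = ≈C-refl ; size-ctx = 0 ; size-split = refl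
  ; refill = λ π' → π' , refl }
plug-split (t ·C C) (app {Γ = Γt} πt ρ q p) = record
  { Γ-ctx      = Γt ⊎C D.Γ-ctx
  ; π-hole     = D.π-hole
  ; ctx-split  = ≈C-trans p (≈C-trans (⊎C-cong ≈C-refl D.ctx-split) (≈C-sym (⊎C-assoc Γt D.Γ-ctx D.Γ-hole)))
  ; size-ctx   = suc (size πt + D.size-ctx)
  ; size-split = cong suc (trans (cong (size πt +_) D.size-split) (sym (+-assoc (size πt) D.size-ctx _)))
  ; refill     = λ {Γ} π' → app πt (proj₁ (D.refill π')) q (⊎C-assoc Γt D.Γ-ctx Γ) ,
      cong suc (trans (cong (size πt +_) (proj₂ (D.refill π'))) (sym (+-assoc (size πt) D.size-ctx (size π'))))
  }
  where module D = PlugSplit (plug-split C ρ)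
plug-split (C C· _) (app {Δ = Δ} πC ρ q p) = record
  { Γ-ctx      = D.Γ-ctx ⊎C Δ
  ; π-hole     = D.π-hole
  ; ctx-split  = ≈C-trans p (≈C-trans (⊎C-cong D.ctx-split ≈C-refl) (⊎C-right-comm D.Γ-ctx D.Γ-hole Δ))
  ; size-ctx   = suc (D.size-ctx + size ρ)
  ; size-split = cong suc (trans (cong (_+ size ρ) D.size-split) (ℕ+.xy∙z≈xz∙y D.size-ctx _ (size ρ)))
  ; refill     = λ {Γ} π' → app (proj₁ (D.refill π')) ρ q (⊎C-right-comm D.Γ-ctx Δ Γ) ,
      cong suc (trans (cong (_+ size ρ) (proj₂ (D.refill π'))) (ℕ+.xy∙z≈xz∙y D.size-ctx (size π') (size ρ)))
  }
  where module D = PlugSplit (plug-split C πC)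

βv-redex : ∀ {Γ t v A} → IsValue v → (π : Γ ⊢ app (lam t) v ∶ A) →
  Σ (Γ ⊢ t ⟦ v ⟧ ∶ A) λ π' → size π ≡ suc (size π')
βv-redex {t = t} {v} iv (app {Δ = Δ} (lam (cons {Γk = Γk} {Mk = M} y y∉ Γk[y] πb []) p) ρ M≈ q)
  with substitution (suc (height πb)) πb (n<1+n _) y iv ρ (trans≈ (≡⇒≈M (,,-here Γk y M)) M≈)
... | π₁ , s₁ with ⊢-cast (≔-open-self y v t y∉) ctx-eq π₁
  where
  ctx-eq : _ ≈C (((Γk ,, y ∶∶ M) ∖ y) ⊎C Δ)
  ctx-eq = ≈C-trans q (⊎C-cong (≈C-trans p (≈C-trans (⊎C-identityʳ Γk) (,,-∖ Γk y M Γk[y]))) ≈C-refl)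
... | π₂ , s₂ , _ = π₂ , cong suc (trans (cong (_+ size ρ) (+-identityʳ (size πb))) (sym (trans s₂ s₁)))

plug-step : ∀ C {Θ s s' A} (π : Θ ⊢ plug C s ∶ A) →
  (∀ {Γ B} (π : Γ ⊢ s ∶ B) → Σ (Γ ⊢ s' ∶ B) λ π' → size π ≡ suc (size π')) →
  Σ (Θ ⊢ plug C s' ∶ A) λ π' → size π ≡ suc (size π')
plug-step C {Θ} {s' = s'} {A} π step = proj₁ cast , (begin
    size π                                 ≡⟨ D.size-split ⟩
    D.size-ctx + size D.π-hole             ≡⟨ cong (D.size-ctx +_) (proj₂ reduced) ⟩
    D.size-ctx + suc (size (proj₁ reduced)) ≡⟨ +-suc D.size-ctx _ ⟩
    suc (D.size-ctx + size (proj₁ reduced)) ≡⟨ cong suc (trans (proj₁ (proj₂ cast)) (proj₂ refilled)) ⟨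
    suc (size (proj₁ cast))                ∎)
  where
  open ≡-Reasoning
  module D = PlugSplit (plug-split C π)
  reduced : Σ (D.Γ-hole ⊢ s' ∶ D.A-hole) λ π' → size D.π-hole ≡ suc (size π')
  reduced = step D.π-hole
  refilled : Σ ((D.Γ-ctx ⊎C D.Γ-hole) ⊢ plug C s' ∶ A) λ π' → size π' ≡ D.size-ctx + size (proj₁ reduced)
  refilled = D.refill (proj₁ reduced)
  cast : Σ (Θ ⊢ plug C s' ∶ A) (_≃ proj₁ refilled)
  cast = ⊢-cast refl D.ctx-split (proj₁ refilled)

βv-program : ∀ C t v E {Θ N} → IsValue v → (π : Θ ⊩ ⟨ plug C (app (lam t) v) , E ⟩ ∶ N) →
  Σ (Θ ⊩ ⟨ plug C (t ⟦ v ⟧) , E ⟩ ∶ N) λ π' → sizeP π ≡ suc (sizeP π')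
βv-program C t v .[] iv (esε π p) with plug-step C π (βv-redex iv)
... | π' , sπ' = esε π' p , sπ'
βv-program C t v E iv (es-app Γ[x] π ρ M≈ E≡ p) with βv-program C t v _ iv π
... | π' , sπ' = es-app Γ[x] π' ρ M≈ E≡ p , cong (_+ size ρ) sπ'

record InertRedex (Γ : Ctx) (t : Tm 1) (i : Tm 0) (x : Var) (A : MTy) : Set where
  field
    {Γ-body Γ-arg} : Ctx
    {M M'}         : MTy
    body           : (Γ-body ,, x ∶∶ M) ⊢ t ^ x ∶ A
    arg            : Γ-arg ⊢ i ∶ M'
    M≈M'           : M ≈M M'
    ctx-split      : Γ ≈C (Γ-body ⊎C Γ-arg)

⊎C-[] : ∀ {Θ} Γ Δ {x} → Θ ≈C (Γ ⊎C Δ) → Θ x ≡ [] → Γ x ≡ [] × Δ x ≡ []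
⊎C-[] Γ Δ {x} p Θ[x] = ++-conicalˡ (Γ x) (Δ x) Γ⊎Δ[x] , ++-conicalʳ (Γ x) (Δ x) Γ⊎Δ[x]
  where Γ⊎Δ[x] : Γ x ++ Δ x ≡ []
        Γ⊎Δ[x] = ≈M-[] (trans≈ (≈M-sym (p x)) (≡⇒≈M Θ[x]))

βi-redex : ∀ {Γ t i A x} → x ∉ fvs t → (π : Γ ⊢ app (lam t) i ∶ A) →
  Σ (InertRedex Γ t i x A) λ r → size π ≡ suc (size (InertRedex.body r) + size (InertRedex.arg r))
βi-redex {t = t} {x = x} x∉ (app πλ@(lam (cons {Γk = Γk} y y∉ Γk[y] πb []) p) ρ M≈ q)
  with rename-premise {t} y∉ Γk[y] x∉ Γk[x] πb
  where Γk[x] : Γk x ≡ []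
        Γk[x] = proj₁ (⊎C-[] Γk ∅C p (relevance πλ x∉))
... | πx , sπx , _ =
  record { body = πx ; arg = ρ ; M≈M' = M≈ ; ctx-split = ≈C-trans q (⊎C-cong (≈C-trans p (⊎C-identityʳ Γk)) ≈C-refl) } ,
  cong (λ n → suc (n + size ρ)) (trans (+-identityʳ (size πb)) (sym sπx))

fvs-plug : ∀ C {s y} → y ∈ fvs s → y ∈ fvs (plug C s)
fvs-plug hole     p = p
fvs-plug (t ·C C) p = ∈-++⁺ʳ (fvs t) (fvs-plug C p)
fvs-plug (C C· _) p = ∈-++⁺ˡ (fvs-plug C p)

βi-term : ∀ C {t i} (ii : IsInert i) x {Θ Γ N} → x ∉ fvs (plug C (app (lam t) i)) → Θ ≈C Γ →
  (π : Γ ⊢ plug C (app (lam t) i) ∶ N) →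
  Σ (Θ ⊩ ⟨ plug C (t ^ x) , (x , (i , ii)) ∷ [] ⟩ ∶ N) λ π' → size π ≡ suc (sizeP π')
βi-term C {t} {i} ii x {N = N} x∉ Θ≈Γ π =
  es-app (cong₂ _++_ Γ-ctx[x] Γ-body[x]) (esε (proj₁ refilled) (⊎C-,,ʳ D.Γ-ctx R.Γ-body x R.M Γ-ctx[x]))
         R.arg R.M≈M' refl
         (≈C-trans Θ≈Γ (≈C-trans D.ctx-split (≈C-trans (⊎C-cong (≈C-refl {D.Γ-ctx}) R.ctx-split)
                                                       (≈C-sym (⊎C-assoc D.Γ-ctx R.Γ-body R.Γ-arg))))) ,
  (begin
    size π                                           ≡⟨ D.size-split ⟩
    D.size-ctx + size D.π-hole                       ≡⟨ cong (D.size-ctx +_) (proj₂ redex) ⟩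
    D.size-ctx + suc (size R.body + size R.arg)      ≡⟨ +-suc D.size-ctx _ ⟩
    suc (D.size-ctx + (size R.body + size R.arg))    ≡⟨ cong suc (+-assoc D.size-ctx _ _) ⟨
    suc (D.size-ctx + size R.body + size R.arg)      ≡⟨ cong (λ n → suc (n + size R.arg)) (proj₂ refilled) ⟨
    suc (size (proj₁ refilled) + size R.arg)         ∎)
  where
  open ≡-Reasoning
  module D = PlugSplit (plug-split C π)
  redex : Σ (InertRedex D.Γ-hole t i x D.A-hole) λ r →
          size D.π-hole ≡ suc (size (InertRedex.body r) + size (InertRedex.arg r))
  redex = βi-redex (x∉ ∘ fvs-plug C ∘ ∈-++⁺ˡ) D.π-hole
  module R = InertRedex (proj₁ redex)
  Γ-ctx[x] : D.Γ-ctx x ≡ []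
  Γ-ctx[x] = proj₁ (⊎C-[] D.Γ-ctx D.Γ-hole D.ctx-split (relevance π x∉))
  Γ-body[x] : R.Γ-body x ≡ []
  Γ-body[x] = proj₁ (⊎C-[] R.Γ-body R.Γ-arg R.ctx-split (proj₂ (⊎C-[] D.Γ-ctx D.Γ-hole D.ctx-split (relevance π x∉))))
  refilled : Σ ((D.Γ-ctx ⊎C (R.Γ-body ,, x ∶∶ R.M)) ⊢ plug C (t ^ x) ∶ N) λ π' → size π' ≡ D.size-ctx + size R.body
  refilled = D.refill R.body

names-++ : ∀ s E L {y} → y ∈ names ⟨ s , E ⟩ → y ∈ names ⟨ s , E ++ L ⟩
names-++ s E L p with ∈-++⁻ (fvs s) p
... | inj₁ q = ∈-++⁺ˡ q
... | inj₂ q = ∈-++⁺ʳ (fvs s) (subst (_ ∈_) (trans (concat-++ (map _ E) (map _ L)) (cong concat (sym (map-++ _ E L)))) (∈-++⁺ˡ q))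

-- The new entry is prepended while (es_@) peels entries off the end of the environment,
-- so the step is pushed beneath all existing entries.
βi-program : ∀ C t i (ii : IsInert i) E x {Θ N} → x ∉ names ⟨ plug C (app (lam t) i) , E ⟩ →
  (π : Θ ⊩ ⟨ plug C (app (lam t) i) , E ⟩ ∶ N) →
  Σ (Θ ⊩ ⟨ plug C (t ^ x) , (x , (i , ii)) ∷ E ⟩ ∶ N) λ π' → sizeP π ≡ suc (sizeP π')
βi-program C t i ii .[] x x∉ (esε π p) = βi-term C ii x (x∉ ∘ ∈-++⁺ˡ) p π
βi-program C t i ii E x x∉ (es-app {E = E₀} {x = y} {i = j} Γ[y] π ρ M≈ refl p)
  with βi-program C t i ii E₀ x (x∉ ∘ names-++ (plug C (app (lam t) i)) E₀ ((y , j) ∷ [])) π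
... | π' , sπ' = es-app Γ[y] π' ρ M≈ refl p , cong (_+ size ρ) sπ'

size-decrement : ∀ {Γ p p' M} (π : Γ ⊩ p ∶ M) → Σ (Γ ⊩ p' ∶ M) (λ π' → sizeP π ≡ suc (sizeP π')) →
  (0 < sizeP π) × Σ (Γ ⊩ p' ∶ M) (λ π' → sizeP π' ≡ sizeP π ∸ 1)
size-decrement π (π' , sπ) rewrite sπ = s≤s z≤n , π' , refl

proposition6 : ∀ {p p' : Program} {Γ : Ctx} {M : MTy} (π : Γ ⊩ p ∶ M) →
    p →βf p' →
    (0 < sizeP π) × Σ (Γ ⊩ p' ∶ M) (λ π' → sizeP π' ≡ sizeP π ∸ 1)
proposition6 π (βv C t v E iv)      = size-decrement π (βv-program C t v E iv π)
proposition6 π (βi C t i ii E x x∉) = size-decrement π (βi-program C t i ii E x x∉ π)
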